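{- Let $\Pi$ be the map on $\mathbb{N}=\{1,2,3,\dots\}$ produced by: at step $1$ set $\Pi(1)=1$; for $m=2,3,\dots$ in turn, at step $m$, if $\Pi(m-\lfloor m/2\rfloor)$ has not been assigned earlier set $\Pi(m-\lfloor m/2\rfloor)=m$, otherwise set $\Pi(m+\lfloor m/2\rfloor)=m$. Let $\Pi_{\rm odd}$ be the map on $\mathbb{N}$ produced by: at step $1$ set $\Pi_{\rm odd}(1)=1$; for $m=2,3,\dots$ in turn, at step $m$, if $m$ is odd or $\Pi_{\rm odd}(m-\lfloor m/2\rfloor)$ has been assigned earlier set $\Pi_{\rm odd}(m+\lfloor m/2\rfloor)=m$, otherwise set $\Pi_{\rm odd}(m-\lfloor m/2\rfloor)=m$. Define $\Pi_\oplus(n)=\Pi(n+1)-1$ for $n\ge1$, and let $s(1),s(2),\dots$ be the even numbers occurring in the sequence $\Pi_{\rm odd}(1),\Pi_{\rm odd}(2),\Pi_{\rm odd}(3),\dots$, listed in their order of appearance. Then for every $n\ge1$, $\Pi_\oplus(n)$ is the position of $n$ in the sequence $(s(m)/2)_{m\ge1}$, i.e. $s(\Pi_\oplus(n))/2=n$.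
   Context: Both procedures assign a value to every $n\in\mathbb{N}$, and $\Pi$ and $\Pi_{\rm odd}$ are permutations of $\mathbb{N}$. -}

module Defs where

open import Data.Nat using (ℕ; zero; suc; _+_; _*_; _∸_; ⌊_/2⌋; _≤_)
open import Data.Nat.Properties using (_≟_)
open import Data.Bool using (Bool; true; false; if_then_else_; _∨_)
open import Data.List using (List; []; _∷_)
open import Data.List.Membership.DecPropositional _≟_ using (_∈?_)
open import Data.Product using (Σ; _×_)
open import Relation.Nullary.Decidable using (⌊_⌋)
open import Relation.Binary.PropositionalEquality using (_≡_)

even : ℕ → Bool
even zero          = true
even (suc zero)    = false
even (suc (suc n)) = even n

odd : ℕ → Bool
odd n = if even n then false else true

lo hi : ℕ → ℕ
lo m = m ∸ ⌊ m /2⌋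
hi m = m + ⌊ m /2⌋

isAssigned : ℕ → List ℕ → Bool
isAssigned k A = ⌊ k ∈? A ⌋

-- Procedure Π.  choiceΠ m A = position assigned at step m ≥ 2, where A is
-- the list of positions assigned in steps 1, …, m-1.
choiceΠ : ℕ → List ℕ → ℕ
choiceΠ m A = if isAssigned (lo m) A then hi m else lo m

assignedΠ : ℕ → List ℕ
assignedΠ zero                = []
assignedΠ (suc zero)          = 1 ∷ []
assignedΠ (suc (suc k))       = choiceΠ (suc (suc k)) (assignedΠ (suc k)) ∷ assignedΠ (suc k)

-- targetΠ m = the position that receives the value m at step m (m ≥ 1).
targetΠ : ℕ → ℕ
targetΠ zero          = zero   -- no step 0 (dummy)
targetΠ (suc zero)    = 1
targetΠ (suc (suc k)) = choiceΠ (suc (suc k)) (assignedΠ (suc k))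

choiceOdd : ℕ → List ℕ → ℕ
choiceOdd m A = if odd m ∨ isAssigned (lo m) A then hi m else lo m

assignedOdd : ℕ → List ℕ
assignedOdd zero          = []
assignedOdd (suc zero)    = 1 ∷ []
assignedOdd (suc (suc k)) = choiceOdd (suc (suc k)) (assignedOdd (suc k)) ∷ assignedOdd (suc k)

targetOdd : ℕ → ℕ
targetOdd zero          = zero
targetOdd (suc zero)    = 1
targetOdd (suc (suc k)) = choiceOdd (suc (suc k)) (assignedOdd (suc k))

-- The value at position k is the step m that writes position k.  Any
-- step m writing k has lo m = k or hi m = k, hence 1 ≤ m ≤ 2k, so it is
-- found by searching m = 2k, 2k-1, …, 1 (taking the last write; under the
-- standing fact that the procedures give permutations there is exactly one).
-- Returns 0 if no step writes k (never happens for k ≥ 1 by the standing fact).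
lastWriter : (ℕ → ℕ) → ℕ → ℕ → ℕ
lastWriter t k zero    = zero
lastWriter t k (suc m) = if ⌊ t (suc m) ≟ k ⌋ then suc m else lastWriter t k m

Π : ℕ → ℕ
Π k = lastWriter targetΠ k (2 * k)

Πodd : ℕ → ℕ
Πodd k = lastWriter targetOdd k (2 * k)

Π⊕ : ℕ → ℕ
Π⊕ n = Π (suc n) ∸ 1

countEven : ℕ → ℕ
countEven zero    = zero
countEven (suc j) = (if even (Πodd (suc j)) then 1 else 0) + countEven j

-- s p ≡ v : v is the p-th even number (p ≥ 1) in the sequence
-- Πodd(1), Πodd(2), …, in order of appearance.
IsS : ℕ → ℕ → Set
IsS p v = Σ ℕ λ j → (1 ≤ j) × (Πodd j ≡ v) × (even v ≡ true) × (countEven j ≡ p)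

-- Both procedures write, at step m, either the lower position lo m = ⌈m/2⌉
-- or the upper position hi m = m + ⌊m/2⌋: odd steps 2c+1 aim at c+1 / 3c+1,
-- even steps 2c at c / 3c.  Π's even steps always go high (their lower
-- position was taken by the preceding odd step); Π_odd's odd steps go high by
-- definition.  The heart of the proof is a duality: Π's odd step 2a+1 goes
-- high exactly when Π_odd's even step 2a goes low.  It is proved by strong
-- induction on a, splitting a modulo 3 and deciding each step by which
-- earlier steps could have occupied its lower position.

module Submission where

open import Defs
open import Data.Nat using (ℕ; zero; suc; _+_; _*_; _∸_; ⌊_/2⌋; ⌈_/2⌉; _%_; _≤_; _<_; s≤s; z≤n; z<s; _≟_)
open import Data.Nat.Properties
open import Data.Nat.DivMod using ([m+kn]%n≡m%n)
open import Data.Nat.Induction using (<-rec)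
open import Data.Nat.Tactic.RingSolver using (solve-∀)
open import Data.Bool using (Bool; true; false; if_then_else_)
open import Data.Bool.Properties using (∨-zeroʳ)
open import Data.List using (List; []; _∷_)
open import Data.List.Membership.Propositional using (_∈_; _∉_)
open import Data.List.Membership.DecPropositional _≟_ using (_∈?_)
open import Data.List.Relation.Unary.Any using (here; there)
open import Data.Product using (Σ; _×_; _,_)
open import Data.Sum using (_⊎_; inj₁; inj₂)
open import Relation.Nullary using (Dec; yes; no; contradiction)
open import Relation.Nullary.Decidable using (isYes≗does; dec-true; dec-false)
open import Relation.Binary.PropositionalEquality
open import Relation.Binary.Definitions using (tri<; tri≈; tri>)

-- Evenness and residues modulo 3 as views, so that case splits expose the
-- closed form of a number.
data Parity : ℕ → Set where
  even-form : ∀ c → Parity (2 * c)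
  odd-form  : ∀ c → Parity (suc (2 * c))

parity : ∀ n → Parity n
parity zero = even-form 0
parity (suc n) with parity n
... | even-form c = odd-form c
... | odd-form c  = subst Parity (*-suc 2 c) (even-form (suc c))

data Residue3 : ℕ → Set where
  multiple : ∀ c → Residue3 (3 * c)
  plus-one : ∀ c → Residue3 (suc (3 * c))
  plus-two : ∀ c → Residue3 (suc (suc (3 * c)))

residue3 : ∀ n → Residue3 n
residue3 zero = multiple 0
residue3 (suc n) with residue3 n
... | multiple c = plus-one c
... | plus-one c = plus-two c
... | plus-two c = subst Residue3 (*-suc 3 c) (multiple (suc c))

residue : ∀ r c → (r + 3 * c) % 3 ≡ r % 3
residue r c = trans (cong (λ x → (r + x) % 3) (*-comm 3 c)) ([m+kn]%n≡m%n r c 3)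

same-residue : ∀ r a s b → r + 3 * a ≡ s + 3 * b → r % 3 ≡ s % 3
same-residue r a s b e = trans (sym (residue r a)) (trans (cong (_% 3) e) (residue s b))

triple≢ : ∀ c → 3 * suc c ≢ suc c
triple≢ c = m+1+n≢m (suc c)

≤-by-offset : ∀ {a b} k → a + k ≡ b → a ≤ b
≤-by-offset {a} k refl = m≤m+n a k

half-even : ∀ c → ⌊ 2 * c /2⌋ ≡ c
half-even zero = refl
half-even (suc c) = trans (cong ⌊_/2⌋ (*-suc 2 c)) (cong suc (half-even c))

half-odd : ∀ c → ⌊ suc (2 * c) /2⌋ ≡ c
half-odd zero = refl
half-odd (suc c) = trans (cong (λ x → ⌊ suc x /2⌋) (*-suc 2 c)) (cong suc (half-odd c))

lo≡⌈/2⌉ : ∀ m → lo m ≡ ⌈ m /2⌉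
lo≡⌈/2⌉ m = trans (cong (_∸ ⌊ m /2⌋) (sym (⌊n/2⌋+⌈n/2⌉≡n m))) (m+n∸m≡n ⌊ m /2⌋ ⌈ m /2⌉)

lo-even : ∀ c → lo (2 * c) ≡ c
lo-even c = trans (lo≡⌈/2⌉ (2 * c)) (half-odd c)

lo-odd : ∀ c → lo (suc (2 * c)) ≡ suc c
lo-odd c = trans (lo≡⌈/2⌉ (suc (2 * c))) (cong suc (half-even c))

hi-even : ∀ c → hi (2 * c) ≡ 3 * c
hi-even c = trans (cong (2 * c +_) (half-even c)) (+-comm (2 * c) c)

hi-odd : ∀ c → hi (suc (2 * c)) ≡ suc (3 * c)
hi-odd c = cong suc (trans (cong (2 * c +_) (half-odd c)) (+-comm (2 * c) c))

step≤2lo : ∀ m → m ≤ 2 * lo m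
step≤2lo m = begin
  m                          ≡⟨ sym (⌊n/2⌋+⌈n/2⌉≡n m) ⟩
  ⌊ m /2⌋ + ⌈ m /2⌉          ≤⟨ +-monoˡ-≤ ⌈ m /2⌉ (⌊n/2⌋≤⌈n/2⌉ m) ⟩
  ⌈ m /2⌉ + ⌈ m /2⌉          ≡⟨ cong (λ x → x + x) (sym (lo≡⌈/2⌉ m)) ⟩
  lo m + lo m                ≡⟨ cong (lo m +_) (sym (+-identityʳ (lo m))) ⟩
  2 * lo m                   ∎
  where open ≤-Reasoning

lo≤hi : ∀ m → lo m ≤ hi m
lo≤hi m = ≤-trans (m∸n≤m m ⌊ m /2⌋) (m≤m+n m ⌊ m /2⌋)

hi-strict : ∀ {m n} → m < n → hi m < hi n
hi-strict m<n = +-mono-<-≤ m<n (⌊n/2⌋-mono (<⇒≤ m<n))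

hi-injective : ∀ {m n} → hi m ≡ hi n → m ≡ n
hi-injective {m} {n} e with <-cmp m n
... | tri< m<n _ _ = contradiction e (<⇒≢ (hi-strict m<n))
... | tri≈ _ m≡n _ = m≡n
... | tri> _ _ n<m = contradiction (sym e) (<⇒≢ (hi-strict n<m))

hi≢2mod3 : ∀ {m c} → hi m ≢ suc (suc (3 * c))
hi≢2mod3 {m} {c} e with parity m
... | even-form d = contradiction (same-residue 0 d 2 c (trans (sym (hi-even d)) e)) λ ()
... | odd-form d  = contradiction (same-residue 1 d 2 c (trans (sym (hi-odd d)) e)) λ ()

even-double : ∀ c → even (2 * c) ≡ true
even-double zero = refl
even-double (suc c) = trans (cong even (*-suc 2 c)) (even-double c)

even-odd : ∀ c → even (suc (2 * c)) ≡ false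
even-odd zero = refl
even-odd (suc c) = trans (cong (λ x → even (suc x)) (*-suc 2 c)) (even-odd c)

isAssigned-∈ : ∀ {k A} → k ∈ A → isAssigned k A ≡ true
isAssigned-∈ {k} {A} k∈A = trans (isYes≗does (k ∈? A)) (dec-true (k ∈? A) k∈A)

isAssigned-∉ : ∀ {k A} → k ∉ A → isAssigned k A ≡ false
isAssigned-∉ {k} {A} k∉A = trans (isYes≗does (k ∈? A)) (dec-false (k ∈? A) k∉A)

choiceΠ-occupied : ∀ m A → lo m ∈ A → choiceΠ m A ≡ hi m
choiceΠ-occupied m A occ rewrite isAssigned-∈ occ = refl

choiceΠ-free : ∀ m A → lo m ∉ A → choiceΠ m A ≡ lo m
choiceΠ-free m A free rewrite isAssigned-∉ free = refl

choiceOdd-occupied : ∀ m A → lo m ∈ A → choiceOdd m A ≡ hi m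
choiceOdd-occupied m A occ rewrite isAssigned-∈ occ | ∨-zeroʳ (odd m) = refl

choiceOdd-odd : ∀ m A → odd m ≡ true → choiceOdd m A ≡ hi m
choiceOdd-odd m A odd-m rewrite odd-m = refl

choiceOdd-free : ∀ m A → odd m ≡ false → lo m ∉ A → choiceOdd m A ≡ lo m
choiceOdd-free m A even-m free rewrite even-m | isAssigned-∉ free = refl

-- A run of a lo/hi procedure is given by the position target (suc k) written
-- at step suc k and the list assigned k of positions written in steps 1..k.
-- The only assumption is the rule shared by Π and Π_odd: each step goes
-- high, or goes low to a free lower position.
StepRule : (ℕ → ℕ) → (ℕ → List ℕ) → ℕ → Set
StepRule target assigned k =
  target (suc k) ≡ hi (suc k) ⊎ (target (suc k) ≡ lo (suc k) × lo (suc k) ∉ assigned k)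

module LoHiRun
  (target : ℕ → ℕ) (assigned : ℕ → List ℕ)
  (assigned-zero : assigned 0 ≡ [])
  (assigned-suc : ∀ k → assigned (suc k) ≡ target (suc k) ∷ assigned k)
  (rule : ∀ k → StepRule target assigned k)
  where

  goesHigh : ∀ k → lo (suc k) ∈ assigned k → target (suc k) ≡ hi (suc k)
  goesHigh k occ with rule k
  ... | inj₁ high = high
  ... | inj₂ (_ , free) = contradiction occ free

  lo≤target : ∀ k → lo (suc k) ≤ target (suc k)
  lo≤target k with rule k
  ... | inj₁ high = subst (lo (suc k) ≤_) (sym high) (lo≤hi (suc k))
  ... | inj₂ (low , _) = ≤-reflexive (sym low)

  target≤hi : ∀ k → target (suc k) ≤ hi (suc k)
  target≤hi k with rule k
  ... | inj₁ high = ≤-reflexive high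
  ... | inj₂ (low , _) = subst (_≤ hi (suc k)) (sym low) (lo≤hi (suc k))

  writtenBefore : ∀ {p} M → p ∈ assigned M → Σ ℕ λ k → k < M × target (suc k) ≡ p
  writtenBefore zero p∈ with subst (_ ∈_) assigned-zero p∈
  ... | ()
  writtenBefore (suc M) p∈ rewrite assigned-suc M with p∈
  ... | here p≡ = M , ≤-refl , sym p≡
  ... | there p∈′ with writtenBefore M p∈′
  ...   | k , k<M , e = k , m≤n⇒m≤1+n k<M , e

  assignedAfter : ∀ {k} M → k < M → target (suc k) ∈ assigned M
  assignedAfter {k} (suc M) k<1+M rewrite assigned-suc M with m≤n⇒m<n∨m≡n (≤-pred k<1+M)
  ... | inj₁ k<M = there (assignedAfter M k<M)
  ... | inj₂ refl = here refl

  assignedBy : ∀ {m p M} → 1 ≤ m → m ≤ M → target m ≡ p → p ∈ assigned M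
  assignedBy {suc k} {M = M} _ le refl = assignedAfter M le

  -- Distinct steps write distinct positions: a later step either goes
  -- strictly above everything earlier or goes low to a free position.
  target-distinct : ∀ {i j} → i < j → target (suc i) ≢ target (suc j)
  target-distinct {i} {j} i<j e with rule j
  ... | inj₁ high = <⇒≢ (≤-<-trans (target≤hi i) (hi-strict (s≤s i<j))) (trans e high)
  ... | inj₂ (low , free) = free (subst (_∈ assigned j) (trans e low) (assignedAfter j i<j))

  target-injective : ∀ {i j} → target (suc i) ≡ target (suc j) → i ≡ j
  target-injective {i} {j} e with <-cmp i j
  ... | tri< i<j _ _ = contradiction e (target-distinct i<j)
  ... | tri≈ _ i≡j _ = i≡j
  ... | tri> _ _ j<i = contradiction (sym e) (target-distinct j<i)

  lastWriter-finds : ∀ {i p} M → target (suc i) ≡ p → suc i ≤ M → lastWriter target p M ≡ suc i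
  lastWriter-finds {i} {p} (suc M) e le with target (suc M) ≟ p
  ... | yes e′ = cong suc (target-injective (trans e′ (sym e)))
  ... | no ne with m≤n⇒m<n∨m≡n le
  ...   | inj₁ lt = lastWriter-finds M e (≤-pred lt)
  ...   | inj₂ refl = contradiction e ne

  inverse : ∀ {m p} → 1 ≤ m → target m ≡ p → lastWriter target p (2 * p) ≡ m
  inverse {suc k} _ refl =
    lastWriter-finds _ refl (≤-trans (step≤2lo (suc k)) (*-monoʳ-≤ 2 (lo≤target k)))

  unassigned : ∀ {p} M → (∀ k → k < M → target (suc k) ≢ p) → p ∉ assigned M
  unassigned M none p∈ with writtenBefore M p∈
  ... | k , k<M , e = none k k<M e

  onlyHiWriter : ∀ {m p} → hi m ≡ p → target m ≢ p →
                 ∀ k → hi (suc k) ≡ p → target (suc k) ≢ p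
  onlyHiWriter {m} hm≡p tm≢p k hk≡p tk≡p =
    tm≢p (subst (λ x → target x ≡ _) (hi-injective (trans hk≡p (sym hm≡p))) tk≡p)

NoHiWriter : (ℕ → ℕ) → ℕ → Set
NoHiWriter target p = ∀ k → hi (suc k) ≡ p → target (suc k) ≢ p

never-hi : ∀ target c → NoHiWriter target (suc (suc (3 * c)))
never-hi _ c k h _ = hi≢2mod3 {suc k} {c} h

Π-assigned-suc : ∀ k → assignedΠ (suc k) ≡ targetΠ (suc k) ∷ assignedΠ k
Π-assigned-suc zero = refl
Π-assigned-suc (suc k) = refl

Π-goesLow : ∀ k → lo (suc k) ∉ assignedΠ k → targetΠ (suc k) ≡ lo (suc k)
Π-goesLow zero _ = refl
Π-goesLow (suc k) free = choiceΠ-free (suc (suc k)) (assignedΠ (suc k)) free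

Π-rule : ∀ k → StepRule targetΠ assignedΠ k
Π-rule zero = inj₁ refl
Π-rule (suc k) = decide (lo (suc (suc k)) ∈? assignedΠ (suc k))
  where
  decide : Dec (lo (suc (suc k)) ∈ assignedΠ (suc k)) → StepRule targetΠ assignedΠ (suc k)
  decide (yes occ) = inj₁ (choiceΠ-occupied (suc (suc k)) (assignedΠ (suc k)) occ)
  decide (no free) = inj₂ (Π-goesLow (suc k) free , free)

module Π-run = LoHiRun targetΠ assignedΠ refl Π-assigned-suc Π-rule

Π-lo-taken : ∀ k → lo (suc k) ∈ assignedΠ (suc k)
Π-lo-taken k with lo (suc k) ∈? assignedΠ k
... | yes occ = subst (lo (suc k) ∈_) (sym (Π-assigned-suc k)) (there occ)
... | no free = subst (lo (suc k) ∈_) (sym (Π-assigned-suc k)) (here (sym (Π-goesLow k free)))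

-- Hence the even step 2c+2, sharing its lower position c+1 with step 2c+1,
-- always goes high, to 3c+3.
Π-even-lo-taken : ∀ c → lo (suc (suc (2 * c))) ∈ assignedΠ (suc (2 * c))
Π-even-lo-taken c = subst (_∈ assignedΠ (suc (2 * c))) lo-same (Π-lo-taken (2 * c))
  where
  lo-same : lo (suc (2 * c)) ≡ lo (suc (suc (2 * c)))
  lo-same = trans (lo-odd c) (sym (trans (cong lo (sym (*-suc 2 c))) (lo-even (suc c))))

Π-even-step : ∀ c → targetΠ (suc (suc (2 * c))) ≡ suc (suc (suc (3 * c)))
Π-even-step c = begin
  targetΠ (suc (suc (2 * c)))  ≡⟨ Π-run.goesHigh (suc (2 * c)) (Π-even-lo-taken c) ⟩
  hi (suc (suc (2 * c)))       ≡⟨ cong hi (sym (*-suc 2 c)) ⟩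
  hi (2 * suc c)               ≡⟨ hi-even (suc c) ⟩
  3 * suc c                    ≡⟨ *-suc 3 c ⟩
  suc (suc (suc (3 * c)))      ∎
  where open ≡-Reasoning

Π-writers : ∀ {k p} → targetΠ (suc k) ≡ p → suc (suc k) ≡ 2 * p ⊎ hi (suc k) ≡ p
Π-writers {k} e with Π-rule k
... | inj₁ high = inj₂ (trans (sym high) e)
... | inj₂ (low , free) with parity k
...   | even-form c = inj₁ (trans (sym (*-suc 2 c))
                              (cong (2 *_) (trans (sym (lo-odd c)) (trans (sym low) e))))
...   | odd-form c = contradiction (Π-even-lo-taken c) free

Π-unassigned : ∀ {p M} → suc M < 2 * p → NoHiWriter targetΠ p → p ∉ assignedΠ M
Π-unassigned {p} {M} bound noHi = Π-run.unassigned M none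
  where
  none : ∀ k → k < M → targetΠ (suc k) ≢ p
  none k k<M e with Π-writers e
  ... | inj₁ step≡ = <-irrefl step≡ (≤-<-trans (s≤s k<M) bound)
  ... | inj₂ hk≡p = noHi k hk≡p e

Π-odd-step-high : ∀ c m → 1 ≤ m → m ≤ 2 * c → targetΠ m ≡ suc c →
                  targetΠ (suc (2 * c)) ≡ suc (3 * c)
Π-odd-step-high c _ pos le e =
  trans (Π-run.goesHigh (2 * c) occ) (hi-odd c)
  where
  occ : lo (suc (2 * c)) ∈ assignedΠ (2 * c)
  occ = subst (_∈ assignedΠ (2 * c)) (sym (lo-odd c)) (Π-run.assignedBy pos le e)

Π-odd-step-low : ∀ c → NoHiWriter targetΠ (suc c) → targetΠ (suc (2 * c)) ≡ suc c
Π-odd-step-low c noHi =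
  trans (Π-goesLow (2 * c) (λ occ → free (subst (_∈ assignedΠ (2 * c)) (lo-odd c) occ))) (lo-odd c)
  where
  free : suc c ∉ assignedΠ (2 * c)
  free = Π-unassigned (≤-reflexive (sym (*-suc 2 c))) noHi

Π⊕-at : ∀ {m n} → targetΠ (suc m) ≡ suc n → Π⊕ n ≡ m
Π⊕-at e = cong (_∸ 1) (Π-run.inverse (s≤s z≤n) e)

Odd-assigned-suc : ∀ k → assignedOdd (suc k) ≡ targetOdd (suc k) ∷ assignedOdd k
Odd-assigned-suc zero = refl
Odd-assigned-suc (suc k) = refl

Odd-rule : ∀ k → StepRule targetOdd assignedOdd k
Odd-rule zero = inj₁ refl
Odd-rule (suc k) = decide (odd (suc (suc k))) refl (lo (suc (suc k)) ∈? assignedOdd (suc k))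
  where
  decide : ∀ b → odd (suc (suc k)) ≡ b → Dec (lo (suc (suc k)) ∈ assignedOdd (suc k)) →
           StepRule targetOdd assignedOdd (suc k)
  decide true  odd-m _         = inj₁ (choiceOdd-odd (suc (suc k)) _ odd-m)
  decide false _     (yes occ) = inj₁ (choiceOdd-occupied (suc (suc k)) _ occ)
  decide false odd-m (no free) = inj₂ (choiceOdd-free (suc (suc k)) _ odd-m free , free)

module Odd-run = LoHiRun targetOdd assignedOdd refl Odd-assigned-suc Odd-rule

Odd-odd-goesHigh : ∀ c → targetOdd (suc (2 * c)) ≡ hi (suc (2 * c))
Odd-odd-goesHigh zero = refl
Odd-odd-goesHigh (suc c) = choiceOdd-odd (suc (2 * suc c)) _ odd-m
  where
  odd-m : odd (suc (2 * suc c)) ≡ true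
  odd-m rewrite even-odd (suc c) = refl

Odd-odd-step : ∀ c → targetOdd (suc (2 * c)) ≡ suc (3 * c)
Odd-odd-step c = trans (Odd-odd-goesHigh c) (hi-odd c)

Odd-writers : ∀ {k p} → targetOdd (suc k) ≡ p → suc k ≡ 2 * p ⊎ hi (suc k) ≡ p
Odd-writers {k} e with Odd-rule k
... | inj₁ high = inj₂ (trans (sym high) e)
... | inj₂ (low , _) with parity k
...   | even-form c = inj₂ (trans (sym (Odd-odd-goesHigh c)) e)
...   | odd-form c = inj₁ (trans (sym (*-suc 2 c))
                              (cong (2 *_) (trans (sym (lo-even (suc c)))
                                (trans (cong lo (*-suc 2 c)) (trans (sym low) e)))))

Odd-unassigned : ∀ {p M} → M < 2 * p → NoHiWriter targetOdd p → p ∉ assignedOdd M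
Odd-unassigned {p} {M} bound noHi = Odd-run.unassigned M none
  where
  none : ∀ k → k < M → targetOdd (suc k) ≢ p
  none k k<M e with Odd-writers e
  ... | inj₁ step≡ = <-irrefl step≡ (≤-<-trans k<M bound)
  ... | inj₂ hk≡p = noHi k hk≡p e

Odd-even-step-free : ∀ b → suc b ∉ assignedOdd (suc (2 * b)) → targetOdd (2 * suc b) ≡ suc b
Odd-even-step-free b free = begin
  targetOdd (2 * suc b)          ≡⟨ cong targetOdd (*-suc 2 b) ⟩
  targetOdd (suc (suc (2 * b)))  ≡⟨ choiceOdd-free (suc (suc (2 * b))) _ even-m lo-free ⟩
  lo (suc (suc (2 * b)))         ≡⟨ lo-eq ⟩
  suc b                          ∎
  where
  open ≡-Reasoning
  lo-eq : lo (suc (suc (2 * b))) ≡ suc b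
  lo-eq = trans (cong lo (sym (*-suc 2 b))) (lo-even (suc b))
  lo-free : lo (suc (suc (2 * b))) ∉ assignedOdd (suc (2 * b))
  lo-free occ = free (subst (_∈ assignedOdd (suc (2 * b))) lo-eq occ)
  even-m : odd (suc (suc (2 * b))) ≡ false
  even-m rewrite even-double b = refl

Odd-even-step-low : ∀ b → NoHiWriter targetOdd (suc b) → targetOdd (2 * suc b) ≡ suc b
Odd-even-step-low b noHi =
  Odd-even-step-free b (Odd-unassigned (≤-reflexive (sym (*-suc 2 b))) noHi)

Odd-even-step-high : ∀ b m → 1 ≤ m → m ≤ suc (2 * b) → targetOdd m ≡ suc b →
                     targetOdd (2 * suc b) ≡ 3 * suc b
Odd-even-step-high b _ pos le e = begin
  targetOdd (2 * suc b)          ≡⟨ cong targetOdd (*-suc 2 b) ⟩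
  targetOdd (suc (suc (2 * b)))  ≡⟨ Odd-run.goesHigh (suc (2 * b)) occ ⟩
  hi (suc (suc (2 * b)))         ≡⟨ cong hi (sym (*-suc 2 b)) ⟩
  hi (2 * suc b)                 ≡⟨ hi-even (suc b) ⟩
  3 * suc b                      ∎
  where
  open ≡-Reasoning
  lo-eq : suc b ≡ lo (suc (suc (2 * b)))
  lo-eq = trans (sym (lo-even (suc b))) (cong lo (*-suc 2 b))
  occ : lo (suc (suc (2 * b))) ∈ assignedOdd (suc (2 * b))
  occ = subst (_∈ assignedOdd (suc (2 * b))) lo-eq (Odd-run.assignedBy pos le e)

Odd-surjective : ∀ b → Σ ℕ λ m → 1 ≤ m × targetOdd m ≡ suc b
Odd-surjective b with suc b ∈? assignedOdd (suc (2 * b))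
... | yes occ with Odd-run.writtenBefore (suc (2 * b)) occ
...   | k , _ , e = suc k , s≤s z≤n , e
Odd-surjective b | no free = 2 * suc b , s≤s z≤n , Odd-even-step-free b free

Πodd-at : ∀ m {p} → 1 ≤ m → targetOdd m ≡ p → Πodd p ≡ m
Πodd-at _ = Odd-run.inverse

-- Positions ≢ 1 (mod 3) receive even values: odd steps write only 3c+1.
Πodd-even-valued : ∀ b → (∀ c → suc b ≢ suc (3 * c)) → even (Πodd (suc b)) ≡ true
Πodd-even-valued b not1mod3 with Odd-surjective b
... | m , pos , e with parity m
...   | even-form c = trans (cong even (Πodd-at (2 * c) pos e)) (even-double c)
...   | odd-form c = contradiction (trans (sym e) (Odd-odd-step c)) (not1mod3 c)

Πodd-odd-valued : ∀ c → even (Πodd (suc (3 * c))) ≡ false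
Πodd-odd-valued c =
  trans (cong even (Πodd-at (suc (2 * c)) (s≤s z≤n) (Odd-odd-step c))) (even-odd c)

data Duality (a : ℕ) : Set where
  Π-high : targetΠ (suc (2 * a)) ≡ suc (3 * a) → targetOdd (2 * a) ≡ a → Duality a
  Π-low  : targetΠ (suc (2 * a)) ≡ suc a → targetOdd (2 * a) ≡ 3 * a → Duality a

-- Position 3c+1 is taken by Π_odd's odd step 2c+1, so step 6c+2 goes high.
Odd-step-1mod3 : ∀ c → targetOdd (2 * suc (3 * c)) ≡ 3 * suc (3 * c)
Odd-step-1mod3 c =
  Odd-even-step-high (3 * c) (suc (2 * c)) (s≤s z≤n) (s≤s (*-monoʳ-≤ 2 (m≤n*m c 3))) (Odd-odd-step c)

Odd-step-triple : ∀ c → targetOdd (2 * suc c) ≡ 3 * suc c →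
                  targetOdd (2 * (3 * suc c)) ≡ 3 * (3 * suc c)
Odd-step-triple c e =
  Odd-even-step-high (c + 2 * suc c) (2 * suc c) (s≤s z≤n) (≤-by-offset (4 * c + 3) (offset c)) e
  where
  offset : ∀ c → 2 * suc c + (4 * c + 3) ≡ suc (2 * (c + 2 * suc c))
  offset = solve-∀

-- At a = 3(c+1) both procedures repeat the choice made at a = c+1.
duality-triple : ∀ c → Duality (suc c) → Duality (3 * suc c)
duality-triple c (Π-high Π≡ Odd≡) =
  Π-high (Π-odd-step-high (3 * suc c) (suc (2 * suc c)) (s≤s z≤n)
                          (≤-by-offset (4 * c + 3) (offset c)) Π≡)
         (Odd-even-step-low (c + 2 * suc c)
                            (Odd-run.onlyHiWriter {2 * suc c} (hi-even (suc c)) Odd≢))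
  where
  offset : ∀ c → suc (2 * suc c) + (4 * c + 3) ≡ 2 * (3 * suc c)
  offset = solve-∀
  Odd≢ : targetOdd (2 * suc c) ≢ 3 * suc c
  Odd≢ e = triple≢ c (trans (sym e) Odd≡)
duality-triple c (Π-low Π≡ Odd≡) =
  Π-low (Π-odd-step-low (3 * suc c) (Π-run.onlyHiWriter {suc (2 * suc c)} (hi-odd (suc c)) Π≢))
        (Odd-step-triple c Odd≡)
  where
  Π≢ : targetΠ (suc (2 * suc c)) ≢ suc (3 * suc c)
  Π≢ e = triple≢ c (suc-injective (trans (sym e) Π≡))

-- Residue 1: Π's lower position 3c+2 is free, Π_odd's 3c+1 is taken;
-- residue 2: Π's lower position 3c+3 is taken, Π_odd's 3c+2 is free.
duality-step : ∀ a → (∀ {b} → b < a → Duality b) → Duality a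
duality-step a ih with residue3 a
... | multiple zero = Π-low refl refl
... | multiple (suc c) = duality-triple c (ih (s≤s (m<m+n c z<s)))
... | plus-one c = Π-low (Π-odd-step-low (suc (3 * c)) (never-hi targetΠ c)) (Odd-step-1mod3 c)
... | plus-two c =
  Π-high (Π-odd-step-high (suc (suc (3 * c))) (suc (suc (2 * c))) (s≤s z≤n)
                          (≤-by-offset (4 * c + 2) (offset c)) (Π-even-step c))
         (Odd-even-step-low (suc (3 * c)) (never-hi targetOdd c))
  where
  offset : ∀ c → suc (suc (2 * c)) + (4 * c + 2) ≡ 2 * suc (suc (3 * c))
  offset = solve-∀

duality : ∀ a → Duality a
duality = <-rec Duality duality-step

-- Counting the even values of Π_odd: among positions 3a+1, 3a+2, 3a+3 the
-- first holds an odd value and the other two even ones.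
indicator : Bool → ℕ
indicator b = if b then 1 else 0

countEven-triple : ∀ a → countEven (3 * a) ≡ 2 * a
countEven-2mod3 : ∀ a → countEven (suc (suc (3 * a))) ≡ suc (2 * a)

countEven-triple zero = refl
countEven-triple (suc a) = begin
  countEven (3 * suc a)                ≡⟨ cong countEven (*-suc 3 a) ⟩
  indicator (even (Πodd (3 + 3 * a))) + countEven (suc (suc (3 * a)))
      ≡⟨ cong₂ _+_ (cong indicator (Πodd-even-valued (suc (suc (3 * a))) not1mod3)) (countEven-2mod3 a) ⟩
  suc (suc (2 * a))                    ≡⟨ sym (*-suc 2 a) ⟩
  2 * suc a                            ∎
  where
  open ≡-Reasoning
  not1mod3 : ∀ c → 3 + 3 * a ≢ suc (3 * c)
  not1mod3 c e = contradiction (same-residue 3 a 1 c e) λ ()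

countEven-2mod3 a =
  cong₂ _+_ (cong indicator (Πodd-even-valued (suc (3 * a)) not1mod3))
            (cong₂ _+_ (cong indicator (Πodd-odd-valued a)) (countEven-triple a))
  where
  not1mod3 : ∀ c → suc (suc (3 * a)) ≢ suc (3 * c)
  not1mod3 c e = contradiction (same-residue 2 a 1 c e) λ ()

countEven-at-low : ∀ n → 1 ≤ n → targetOdd (2 * n) ≡ n → countEven n ≡ Π⊕ n
countEven-at-low n pos Odd≡ with residue3 n
countEven-at-low .(3 * 0) () _ | multiple zero
countEven-at-low .(3 * suc c) _ Odd≡ | multiple (suc c) with duality (suc c)
... | Π-high Π≡ _ = trans (countEven-triple (suc c)) (sym (Π⊕-at Π≡))
... | Π-low _ Odd≡′ =
  contradiction (trans (sym (Odd-step-triple c Odd≡′)) Odd≡) (triple≢ (c + 2 * suc c))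
countEven-at-low .(suc (3 * c)) _ Odd≡ | plus-one c =
  contradiction (trans (sym (Odd-step-1mod3 c)) Odd≡) (triple≢ (3 * c))
countEven-at-low .(suc (suc (3 * c))) _ _ | plus-two c =
  trans (countEven-2mod3 c) (sym (Π⊕-at (Π-even-step c)))

-- The theorem: 2n is the (Π⊕ n)-th even value of Π_odd.  It sits at the
-- position j = targetOdd (2n) ∈ {n, 3n}; by duality j = 3n exactly when Π
-- writes n+1 at step 2n+1.
proposition7 : (n : ℕ) → 1 ≤ n → IsS (Π⊕ n) (2 * n)
proposition7 zero ()
proposition7 (suc d) pos with duality (suc d)
... | Π-low Π≡ Odd≡ =
  3 * suc d , s≤s z≤n , Πodd-at (2 * suc d) (s≤s z≤n) Odd≡ , even-double (suc d) ,
  trans (countEven-triple (suc d)) (sym (Π⊕-at Π≡))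
... | Π-high _ Odd≡ =
  suc d , pos , Πodd-at (2 * suc d) (s≤s z≤n) Odd≡ , even-double (suc d) ,
  countEven-at-low (suc d) pos Odd≡
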